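{- The infinite word $\mathbf{b}$ is recurrent, i.e., every finite factor of $\mathbf{b}$ occurs infinitely often in $\mathbf{b}$.
   Context: Define finite binary words $B_i$ by $B_1 = 101$ and $B_{i+1} = B_i C_i$ for $i \geq 1$, where $C_i$ is the word obtained from $B_i$ by removing its first $i$ symbols. Since each $B_i$ is a prefix of $B_{i+1}$, there is a unique infinite binary word $\mathbf{b} = 10101101011011101\cdots$ of which every $B_i$ is a prefix. -}

module Defs where

open import Data.Bool using (Bool; true; false)
open import Data.Nat using (ℕ; zero; suc; _+_; _<_)
open import Data.List using (List; []; _∷_; _++_; drop)
open import Data.Product using (Σ; _×_)
open import Relation.Binary.PropositionalEquality using (_≡_)

-- Binary letters: true = 1, false = 0.

-- Bw k is the paper's word B_(k+1):
--   Bw 0 = B_1 = 101,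
--   Bw (suc k) = B_(k+2) = B_(k+1) C_(k+1), where C_(k+1) = B_(k+1) with its first (k+1) symbols removed.
Bw : ℕ → List Bool
Bw zero = true ∷ false ∷ true ∷ []
Bw (suc k) = Bw k ++ drop (suc k) (Bw k)

at : List Bool → ℕ → Bool
at [] n = false
at (x ∷ xs) zero = x
at (x ∷ xs) (suc n) = at xs n

-- The infinite word b, as a function ℕ → Bool (0-based positions).
-- Since every B_i is a prefix of b and |B_(n+1)| ≥ n + 3 > n, symbol n of b is symbol n of B_(n+1).
b : ℕ → Bool
b n = at (Bw n) n

OccursAt : (ℕ → Bool) → ℕ → ℕ → ℕ → Set
OccursAt w i m j = ∀ k → k < m → w (j + k) ≡ w (i + k)

Recurrent : (ℕ → Bool) → Set
Recurrent w = ∀ i m N → Σ ℕ (λ j → (N < j) × OccursAt w i m j)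

{-# OPTIONS --safe #-}
-- Since B_(e+2) = B_(e+1) C_(e+1), the word b repeats with period |C_(e+1)| = 2^e + 1
-- on the positions e+1, …, |B_(e+1)| - 1.  Hence a prefix of b that is a suffix of
-- B_(e+1) and no longer than C_(e+1) lies inside C_(e+1), so it is also a suffix of
-- B_(e+2), and then of every later B.  Starting from "B_(s+1) is a suffix of B_(s+2)",
-- this makes the prefix of length k+1 = |B_(s+1)| a suffix of B_(k+1), and the same
-- periodicity then turns B_(k+1) into a suffix of B_(k+2).  So infinitely many
-- prefixes B_(s+1) of b reoccur at position 2^s + 1, which gives recurrence.
module Submission where

open import Defs
open import Data.Bool using (Bool)
open import Data.Nat
open import Data.Nat.Properties
open import Data.List using (List; []; _∷_; _++_; drop; length)
open import Data.List.Properties using (length-++; length-drop; ++-assoc; ++-identityʳ)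
open import Data.Product using (Σ; _×_; _,_)
open import Data.Sum using (inj₁; inj₂)
open import Relation.Nullary using (yes; no)
open import Relation.Binary.PropositionalEquality
open import Data.Nat.Tactic.RingSolver using (solve-∀)

at-++ˡ : ∀ (xs ys : List Bool) {n} → n < length xs → at (xs ++ ys) n ≡ at xs n
at-++ˡ (x ∷ xs) ys {zero}  _         = refl
at-++ˡ (x ∷ xs) ys {suc n} (s≤s n<) = at-++ˡ xs ys n<

at-++ʳ : ∀ (xs ys : List Bool) n → at (xs ++ ys) (length xs + n) ≡ at ys n
at-++ʳ []       ys n = refl
at-++ʳ (x ∷ xs) ys n = at-++ʳ xs ys n

at-drop : ∀ d (xs : List Bool) n → at (drop d xs) n ≡ at xs (d + n)
at-drop zero    xs       n = refl
at-drop (suc d) []       n = refl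
at-drop (suc d) (x ∷ xs) n = at-drop d xs n

n<2^n : ∀ n → n < 2 ^ n
n<2^n zero    = z<s
n<2^n (suc n) = subst (suc (suc n) ≤_) (cong (2 ^ n +_) (sym (+-identityʳ (2 ^ n))))
  (+-mono-≤ (m^n>0 2 n) (n<2^n n))

-- lenB e and lenC e are the lengths of B_(e+1) and C_(e+1).
lenC : ℕ → ℕ
lenC e = suc (2 ^ e)

lenB : ℕ → ℕ
lenB e = suc e + lenC e

lenB-suc : ∀ e → lenB (suc e) ≡ lenB e + lenC e
lenB-suc e = identity (2 ^ e) e
  where
  identity : ∀ x e → suc (suc e) + suc (x + (x + 0)) ≡ suc e + suc x + suc x
  identity = solve-∀

lenC-mono : ∀ e → lenC e ≤ lenC (suc e)
lenC-mono e = s≤s (m≤m+n (2 ^ e) (2 ^ e + 0))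

lenB≤lenC-suc : ∀ e → lenB e ≤ lenC (suc e)
lenB≤lenC-suc e = s≤s (begin
  e + suc (2 ^ e)    ≡⟨ +-suc e (2 ^ e) ⟩
  suc e + 2 ^ e      ≤⟨ +-monoˡ-≤ (2 ^ e) (n<2^n e) ⟩
  2 ^ e + 2 ^ e      ≡⟨ cong (2 ^ e +_) (+-identityʳ (2 ^ e)) ⟨
  2 ^ suc e          ∎)
  where open ≤-Reasoning

length-Bw : ∀ e → length (Bw e) ≡ lenB e
length-Bw zero    = refl
length-Bw (suc e) = begin
  length (Bw e ++ drop (suc e) (Bw e))          ≡⟨ length-++ (Bw e) ⟩
  length (Bw e) + length (drop (suc e) (Bw e))  ≡⟨ cong (length (Bw e) +_) (length-drop (suc e) (Bw e)) ⟩
  length (Bw e) + (length (Bw e) ∸ suc e)       ≡⟨ cong (λ l → l + (l ∸ suc e)) (length-Bw e) ⟩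
  lenB e + (lenB e ∸ suc e)                     ≡⟨ cong (lenB e +_) (m+n∸m≡n (suc e) (lenC e)) ⟩
  lenB e + lenC e                               ≡⟨ lenB-suc e ⟨
  lenB (suc e)                                  ∎
  where open ≡-Reasoning

Bw-prefix : ∀ {e e′} → e ≤‴ e′ → Σ (List Bool) λ ys → Bw e′ ≡ Bw e ++ ys
Bw-prefix {e} ≤‴-refl        = [] , sym (++-identityʳ (Bw e))
Bw-prefix {e} (≤‴-step e<e′) with Bw-prefix e<e′
... | ys , eq = drop (suc e) (Bw e) ++ ys , trans eq (++-assoc (Bw e) _ ys)

at-Bw-≤ : ∀ {e e′ x} → e ≤ e′ → x < lenB e → at (Bw e′) x ≡ at (Bw e) x
at-Bw-≤ {e} e≤e′ x< with Bw-prefix (≤⇒≤‴ e≤e′)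
... | ys , eq = trans (cong (λ w → at w _) eq) (at-++ˡ (Bw e) ys (subst (_ <_) (sym (length-Bw e)) x<))

b≡at-Bw : ∀ e {x} → x < lenB e → b x ≡ at (Bw e) x
b≡at-Bw e {x} x< with ≤-total x e
... | inj₁ x≤e = sym (at-Bw-≤ x≤e (m≤m+n (suc x) (lenC x)))
... | inj₂ e≤x = at-Bw-≤ e≤x x<

b-C : ∀ e u → u < lenC e → b (lenB e + u) ≡ b (suc e + u)
b-C e u u< = begin
  b (lenB e + u)                               ≡⟨ b≡at-Bw (suc e) (subst (lenB e + u <_) (sym (lenB-suc e)) (+-monoʳ-< (lenB e) u<)) ⟩
  at (Bw (suc e)) (lenB e + u)                 ≡⟨ cong (λ l → at (Bw (suc e)) (l + u)) (length-Bw e) ⟨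
  at (Bw (suc e)) (length (Bw e) + u)          ≡⟨ at-++ʳ (Bw e) _ u ⟩
  at (drop (suc e) (Bw e)) u                   ≡⟨ at-drop (suc e) (Bw e) u ⟩
  at (Bw e) (suc e + u)                        ≡⟨ b≡at-Bw e (+-monoʳ-< (suc e) u<) ⟨
  b (suc e + u)                                ∎
  where open ≡-Reasoning

b-periodic : ∀ e {x} → e < x → x < lenB e → b (lenC e + x) ≡ b x
b-periodic e e<x x< with m≤n⇒∃[o]m+o≡n e<x
... | u , refl = trans (cong b shift) (b-C e u (+-cancelˡ-< (suc e) u (lenC e) x<))
  where
  shift : lenC e + (suc e + u) ≡ lenB e + u
  shift = trans (sym (+-assoc (lenC e) (suc e) u)) (cong (_+ u) (+-comm (lenC e) (suc e)))

occursAt-factor : ∀ {w n p i m} → OccursAt w 0 n p → i + m ≤ n → OccursAt w i m (p + i)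
occursAt-factor {w} {n} {p} {i} occ i+m≤n k k<m =
  trans (cong w (+-assoc p i k)) (occ (i + k) (<-≤-trans (+-monoʳ-< i k<m) i+m≤n))

HasBorder : ℕ → ℕ → Set
HasBorder e m = Σ ℕ λ p → p + m ≡ lenB e × OccursAt b 0 m p

hasBorder-suc : ∀ {e m} → m ≤ lenC e → HasBorder e m → HasBorder (suc e) m
hasBorder-suc {e} {m} m≤ (p , p+m≡ , occ) = lenC e + p , ends , occ′
  where
  e<p : e < p
  e<p = +-cancelʳ-≤ m (suc e) p (subst (suc e + m ≤_) (sym p+m≡) (+-monoʳ-≤ (suc e) m≤))
  ends : lenC e + p + m ≡ lenB (suc e)
  ends = begin
    lenC e + p + m    ≡⟨ +-assoc (lenC e) p m ⟩
    lenC e + (p + m)  ≡⟨ cong (lenC e +_) p+m≡ ⟩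
    lenC e + lenB e   ≡⟨ +-comm (lenC e) (lenB e) ⟩
    lenB e + lenC e   ≡⟨ lenB-suc e ⟨
    lenB (suc e)      ∎
    where open ≡-Reasoning
  occ′ : OccursAt b 0 m (lenC e + p)
  occ′ t t<m = begin
    b (lenC e + p + t)    ≡⟨ cong b (+-assoc (lenC e) p t) ⟩
    b (lenC e + (p + t))  ≡⟨ b-periodic e (<-≤-trans e<p (m≤m+n p t))
                               (subst (p + t <_) p+m≡ (+-monoʳ-< p t<m)) ⟩
    b (p + t)             ≡⟨ occ t t<m ⟩
    b t                   ∎
    where open ≡-Reasoning

hasBorder-≤ : ∀ {e e′ m} → e ≤ e′ → m ≤ lenC e → HasBorder e m → HasBorder e′ m
hasBorder-≤ e≤e′ = go (≤⇒≤‴ e≤e′)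
  where
  go : ∀ {e e′ m} → e ≤‴ e′ → m ≤ lenC e → HasBorder e m → HasBorder e′ m
  go         ≤‴-refl        m≤ border = border
  go {e = e} (≤‴-step e<e′) m≤ border = go e<e′ (≤-trans m≤ (lenC-mono e)) (hasBorder-suc m≤ border)

IsSuffixOfNext : ℕ → Set
IsSuffixOfNext s = OccursAt b 0 (lenB s) (lenC s)

isSuffixOfNext-zero : IsSuffixOfNext 0
isSuffixOfNext-zero zero                _ = refl
isSuffixOfNext-zero (suc zero)          _ = refl
isSuffixOfNext-zero (suc (suc zero))    _ = refl
isSuffixOfNext-zero (suc (suc (suc t))) (s≤s (s≤s (s≤s ())))

prefix-extend : ∀ k → OccursAt b 0 (suc k) (lenC k) → IsSuffixOfNext k
prefix-extend k occ t t< with t <? suc k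
... | yes t≤k = occ t t≤k
... | no  t≰k = b-periodic k (≮⇒≥ t≰k) t<

hasBorder⇒isSuffixOfNext : ∀ k → HasBorder k (suc k) → IsSuffixOfNext k
hasBorder⇒isSuffixOfNext k (p , p+k≡ , occ) = prefix-extend k (subst (OccursAt b 0 (suc k)) p≡lenC occ)
  where
  p≡lenC : p ≡ lenC k
  p≡lenC = +-cancelʳ-≡ (suc k) p (lenC k) (trans p+k≡ (+-comm (suc k) (lenC k)))

isSuffixOfNext-step : ∀ s → IsSuffixOfNext s → IsSuffixOfNext (s + lenC s)
isSuffixOfNext-step s occ =
  hasBorder⇒isSuffixOfNext (s + lenC s) (hasBorder-≤ (m<m+n s z<s) (lenB≤lenC-suc s) border)
  where
  border : HasBorder (suc s) (lenB s)
  border = lenC s , trans (+-comm (lenC s) (lenB s)) (sym (lenB-suc s)) , occ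

isSuffixOfNext-unbounded : ∀ n → Σ ℕ λ s → n ≤ s × IsSuffixOfNext s
isSuffixOfNext-unbounded zero = 0 , z≤n , isSuffixOfNext-zero
isSuffixOfNext-unbounded (suc n) with isSuffixOfNext-unbounded n
... | s , n≤s , occ = s + lenC s , ≤-trans (s≤s n≤s) (m<m+n s z<s) , isSuffixOfNext-step s occ

theorem3 : Recurrent b
theorem3 i m N with isSuffixOfNext-unbounded (N ⊔ (i + m))
... | s , N⊔i+m≤s , occ = lenC s + i , N<j , occursAt-factor {p = lenC s} occ i+m≤lenB
  where
  N<j : N < lenC s + i
  N<j = ≤-trans (s≤s (≤-trans (m≤m⊔n N (i + m)) (≤-trans N⊔i+m≤s (<⇒≤ (n<2^n s)))))
                (m≤m+n (lenC s) i)
  i+m≤lenB : i + m ≤ lenB s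
  i+m≤lenB = ≤-trans (m≤n⊔m N (i + m)) (≤-trans N⊔i+m≤s (≤-trans (n≤1+n s) (m≤m+n (suc s) (lenC s))))
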